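{- The cycle $C_7$ is not thrifty, is not greedy, and satisfies $c_r(C_7)>2^d$, where $d=3$ is the diameter of $C_7$.
   Context: A pebbling distribution assigns to each vertex a non-negative integer number of pebbles; a rooted distribution fixes a root $r$. A pebbling step $[a,b]$, for adjacent $a,b$, removes two pebbles from $a$ and adds one to $b$; it is greedy if $d(a,r)>d(b,r)$ ($d$ = graph distance). A rooted distribution is $r$-solvable if some sequence of pebbling steps (a solution) ends with at least one pebble on $r$; it is greedy if it has a solution using only greedy steps; it is $r$-critical if it is $r$-solvable but removing any single pebble makes it not $r$-solvable. The pebbling number $p(G)$ is the minimum number such that every distribution with $p(G)$ pebbles is $r$-solvable for every $r$. A graph $G$ is greedy if every rooted distribution (for every root) with at least $p(G)$ pebbles is greedy. $c_r(G)$ is the largest size of an $r$-critical rooted distribution on $G$ over all roots; an $r$-ceiling distribution is an $r$-critical rooted distribution with exactly $c_r(G)$ pebbles; $G$ is thrifty if every $r$-ceiling distribution is greedy. -}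

module Defs where

open import Data.Nat using (ℕ; zero; suc; _+_; _∸_; _≤_; _<_; _⊔_; _⊓_; ∣_-_∣; _%_)
open import Data.Fin using (Fin; toℕ; _≟_)
open import Data.List using (List; map; allFin)
open import Data.Nat.ListAction using (sum)
open import Data.Product using (Σ; _×_; _,_)
open import Data.Sum using (_⊎_)
open import Data.Unit using (⊤)
open import Relation.Nullary using (¬_; yes; no)
open import Relation.Binary.PropositionalEquality using (_≡_)

record Graph : Set₁ where
  field
    n    : ℕ
    Adj  : Fin n → Fin n → Set
    dist : Fin n → Fin n → ℕ

module _ (G : Graph) where
  open Graph G

  Dist : Set
  Dist = Fin n → ℕ

  size : Dist → ℕ
  size D = sum (map D (allFin n))

  applyStep : Dist → Fin n → Fin n → Dist
  applyStep D a b w =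
    (D w ∸ (case-a w)) + (case-b w)
    where
      case-a : Fin n → ℕ
      case-a w with w ≟ a
      ... | yes _ = 2
      ... | no  _ = 0
      case-b : Fin n → ℕ
      case-b w with w ≟ b
      ... | yes _ = 1
      ... | no  _ = 0

  removeOne : Dist → Fin n → Dist
  removeOne D v w with w ≟ v
  ... | yes _ = D w ∸ 1
  ... | no  _ = D w

  GreedyStep : Fin n → Fin n → Fin n → Set
  GreedyStep r a b = dist b r < dist a r

  data Reach (P : Fin n → Fin n → Set) : Dist → Dist → Set where
    done : ∀ {D} → Reach P D D
    step : ∀ {D E} (a b : Fin n) → Adj a b → 2 ≤ D a → P a b →
           Reach P (applyStep D a b) E → Reach P D E

  NoRestriction : Fin n → Fin n → Set
  NoRestriction _ _ = ⊤

  Solvable : Dist → Fin n → Set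
  Solvable D r = Σ Dist λ E → Reach NoRestriction D E × 1 ≤ E r

  GreedySolvable : Dist → Fin n → Set
  GreedySolvable D r = Σ Dist λ E → Reach (GreedyStep r) D E × 1 ≤ E r

  Critical : Dist → Fin n → Set
  Critical D r = Solvable D r × (∀ v → 1 ≤ D v → ¬ Solvable (removeOne D v) r)

  IsPebblingNumber : ℕ → Set
  IsPebblingNumber p =
    (∀ (D : Dist) r → size D ≡ p → Solvable D r) ×
    (∀ q → q < p → ¬ (∀ (D : Dist) r → size D ≡ q → Solvable D r))

  IsGreedyGraph : Set
  IsGreedyGraph = ∀ p → IsPebblingNumber p → ∀ (D : Dist) r → p ≤ size D → GreedySolvable D r

  IsCriticalCeiling : ℕ → Set
  IsCriticalCeiling c =
    (Σ (Fin n) λ r → Σ Dist λ D → Critical D r × size D ≡ c) ×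
    (∀ r (D : Dist) → Critical D r → size D ≤ c)

  IsThrifty : Set
  IsThrifty = ∀ c → IsCriticalCeiling c → ∀ r (D : Dist) → Critical D r → size D ≡ c → GreedySolvable D r

C7 : Graph
C7 = record
  { n    = 7
  ; Adj  = λ i j → (toℕ j ≡ (toℕ i + 1) % 7) ⊎ (toℕ i ≡ (toℕ j + 1) % 7)
  ; dist = λ i j → ∣ toℕ i - toℕ j ∣ ⊓ (7 ∸ ∣ toℕ i - toℕ j ∣)
  }

-- Everything rests on one finite fact: every distribution of 11 pebbles on C₇ has a
-- pebble whose removal leaves it solvable.  This gives p(C₇) ≤ 11 and bounds every
-- critical distribution by 10 pebbles.  For root 0 the fact is checked on all 12376
-- distributions, each time exhibiting a solution that pushes the pebbles along one of
-- the arcs 4→3→2→1→0 or 3→4→5→6→0; rotating the cycle carries it to every root.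
-- Exhaustive search, which terminates because every step loses a pebble, supplies the
-- rest (vertices listed as 0,…,6): (0,0,0,5,5,0,0) cannot reach 0, so p(C₇) = 11;
-- (0,0,0,4,6,0,0) is 0-critical with 10 pebbles, so c_r(C₇) = 10 > 2³, yet it has no
-- greedy solution, and neither has (0,0,0,4,7,0,0) with 11 pebbles.
module Submission where

open import Defs
open import Data.Nat using (_<_; _^_)
open import Data.Product using (Σ; _×_)
open import Relation.Nullary using (¬_)

open import Algebra.Properties.CommutativeSemigroup using (interchange)
open import Data.Bool using (Bool; T; _∧_; _∨_)
open import Data.Bool.ListAction using (any; all)
open import Data.Bool.Properties using (T-∧; T-∨)
open import Data.Fin using (Fin; zero; suc; toℕ; fromℕ<; #_)
open import Data.Fin.Properties using (_≟_; toℕ-injective; toℕ-fromℕ<; any?; all?)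
import Data.Fin.Properties as Fin
open import Data.List using (List; []; _∷_; _++_; map; tabulate; allFin; concatMap; upTo; replicate)
open import Data.List.Membership.Propositional using (_∈_; lose)
open import Data.List.Membership.Propositional.Properties
  using (∈-allFin; ∈-concatMap⁺; ∈-map⁺; ∈-upTo⁺)
open import Data.List.Properties using (map-tabulate; tabulate-cong; map-cong)
open import Data.List.Relation.Unary.All as All using ()
open import Data.List.Relation.Unary.All.Properties using (all⁺)
open import Data.List.Relation.Unary.Any using (satisfied; here; there)
open import Data.List.Relation.Unary.Any.Properties using (any⁺; any⁻)
open import Data.Nat using (ℕ; zero; suc; _+_; _∸_; _≤_; _≤ᵇ_; _≡ᵇ_; z≤n; s≤s; _%_; _/_)
open import Data.Nat.DivMod using (m%n<n)
open import Data.Nat.ListAction using (sum)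
open import Data.Nat.ListAction.Properties using (sum-++)
open import Data.Nat.Properties
  using ( +-commutativeSemigroup; +-identityʳ; +-suc; +-comm; m∸n+n≡m; m+n∸m≡n; m≤m+n
        ; ≤-refl; ≤-reflexive; ≤-trans; ≤-pred; +-monoˡ-≤; ∸-monoˡ-≤; m∸n≤m; suc-injective
        ; n<1⇒n≡0; ≰⇒>; _≤?_; _<?_; ≤ᵇ⇒≤; ≤⇒≤ᵇ; ≡ᵇ⇒≡; ≡⇒≡ᵇ )
open import Data.Product using (_,_; ∃-syntax)
open import Data.Sum using (_⊎_; inj₁; inj₂)
open import Data.Unit using (tt)
open import Data.Vec as Vec using (Vec; lookup; updateAt; []; _∷_)
open import Data.Vec.Properties using (lookup∘tabulate; lookup∘updateAt; lookup∘updateAt′)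
open import Function using (id; _∘_; Equivalence)
open import Relation.Nullary using (Dec; yes; no; contradiction)
open import Relation.Nullary.Decidable
  using (T?; isYes; map′; from-yes; from-no; toWitness; fromWitness; _→-dec_; _×-dec_; ¬?)
open import Relation.Binary.PropositionalEquality
  using (_≡_; _≗_; refl; sym; trans; cong; cong₂; subst; module ≡-Reasoning)

δ : ∀ {n} → ℕ → Fin n → Fin n → ℕ
δ k a w with w ≟ a
... | yes _ = k
... | no  _ = 0

δ-≤ : ∀ {n} {k} {D : Fin n → ℕ} {a} → k ≤ D a → ∀ w → δ k a w ≤ D w
δ-≤ {a = a} k≤Da w with w ≟ a
... | yes refl = k≤Da
... | no  _    = z≤n

δ-injective : ∀ {m n} {π : Fin m → Fin n} → (∀ {a b} → π a ≡ π b → a ≡ b) →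
              ∀ k a w → δ k (π a) (π w) ≡ δ k a w
δ-injective {π = π} π-inj k a w with π w ≟ π a | w ≟ a
... | yes _   | yes _   = refl
... | no  _   | no  _   = refl
... | yes πw≡πa | no w≢a = contradiction (π-inj πw≡πa) w≢a
... | no πw≢πa  | yes w≡a = contradiction (cong π w≡a) πw≢πa

sum-tabulate-+ : ∀ {n} (f g : Fin n → ℕ) →
                 sum (tabulate (λ w → f w + g w)) ≡ sum (tabulate f) + sum (tabulate g)
sum-tabulate-+ {zero}  f g = refl
sum-tabulate-+ {suc n} f g = begin
  f zero + g zero + sum (tabulate (λ w → f (suc w) + g (suc w)))
    ≡⟨ cong (f zero + g zero +_) (sum-tabulate-+ (f ∘ suc) (g ∘ suc)) ⟩
  f zero + g zero + (sum (tabulate (f ∘ suc)) + sum (tabulate (g ∘ suc)))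
    ≡⟨ interchange +-commutativeSemigroup (f zero) (g zero) _ _ ⟩
  f zero + sum (tabulate (f ∘ suc)) + (g zero + sum (tabulate (g ∘ suc)))  ∎
  where open ≡-Reasoning

sum-tabulate-0 : ∀ n → sum (tabulate {n = n} (λ _ → 0)) ≡ 0
sum-tabulate-0 zero    = refl
sum-tabulate-0 (suc n) = sum-tabulate-0 n

sum-tabulate-δ : ∀ {n} k (a : Fin n) → sum (tabulate (δ k a)) ≡ k
sum-tabulate-δ {suc n} k zero    = trans (cong (k +_) (sum-tabulate-0 n)) (+-identityʳ k)
sum-tabulate-δ {suc n} k (suc a) =
  trans (cong sum (tabulate-cong (δ-injective Fin.suc-injective k a)))
        (sum-tabulate-δ k a)

lookup-updateAt-∸ : ∀ {n} (t : Vec ℕ n) k a w →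
                    lookup (updateAt t a (_∸ k)) w ≡ lookup t w ∸ δ k a w
lookup-updateAt-∸ t k a w with w ≟ a
... | yes refl = lookup∘updateAt a t
... | no  w≢a  = lookup∘updateAt′ w a w≢a t

lookup-updateAt-+ : ∀ {n} (t : Vec ℕ n) k a w →
                    lookup (updateAt t a (_+ k)) w ≡ lookup t w + δ k a w
lookup-updateAt-+ t k a w with w ≟ a
... | yes refl = lookup∘updateAt a t
... | no  w≢a  = trans (lookup∘updateAt′ w a w≢a t) (sym (+-identityʳ _))

stepᵛ : ∀ {n} → Vec ℕ n → Fin n → Fin n → Vec ℕ n
stepᵛ t a b = updateAt (updateAt t a (_∸ 2)) b (_+ 1)

removeᵛ : ∀ {n} → Vec ℕ n → Fin n → Vec ℕ n
removeᵛ t v = updateAt t v (_∸ 1)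

compositions : ∀ n → ℕ → List (Vec ℕ n)
compositions zero    zero    = [] ∷ []
compositions zero    (suc _) = []
compositions (suc n) s = concatMap (λ k → map (k ∷_) (compositions n (s ∸ k))) (upTo (suc s))

∈-compositions : ∀ {n} (t : Vec ℕ n) → t ∈ compositions n (Vec.sum t)
∈-compositions []      = here refl
∈-compositions (x ∷ t) = ∈-concatMap⁺ (λ k → map (k ∷_) (compositions _ (x + Vec.sum t ∸ k)))
  (lose (∈-upTo⁺ (s≤s (m≤m+n x (Vec.sum t))))
    (∈-map⁺ (x ∷_) (subst (λ s → t ∈ compositions _ s) (sym (m+n∸m≡n x (Vec.sum t)))
                          (∈-compositions t))))

sweep : ∀ {n} → Vec ℕ n → List (Fin n) → List (Fin n × Fin n)
sweep {n} t []          = []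
sweep {n} t (a ∷ route) = go (lookup t a) a route
  where
  go : ℕ → Fin n → List (Fin n) → List (Fin n × Fin n)
  go c a []          = []
  go c a (b ∷ route) = replicate (c / 2) (a , b) ++ go (lookup t b + c / 2) b route

module Pebbling (G : Graph) where
  open Graph G

  applyStep-δ : ∀ D a b → applyStep G D a b ≗ λ w → D w ∸ δ 2 a w + δ 1 b w
  applyStep-δ D a b w with w ≟ a | w ≟ b
  ... | yes _ | yes _ = refl
  ... | yes _ | no  _ = refl
  ... | no  _ | yes _ = refl
  ... | no  _ | no  _ = refl

  removeOne-δ : ∀ D v → removeOne G D v ≗ λ w → D w ∸ δ 1 v w
  removeOne-δ D v w with w ≟ v
  ... | yes _ = refl
  ... | no  _ = refl

  applyStep-cong : ∀ {D D′} a b → D ≗ D′ → applyStep G D a b ≗ applyStep G D′ a b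
  applyStep-cong {D} {D′} a b D≗D′ w = begin
    applyStep G D a b w          ≡⟨ applyStep-δ D a b w ⟩
    D w ∸ δ 2 a w + δ 1 b w      ≡⟨ cong (λ x → x ∸ δ 2 a w + δ 1 b w) (D≗D′ w) ⟩
    D′ w ∸ δ 2 a w + δ 1 b w     ≡⟨ applyStep-δ D′ a b w ⟨
    applyStep G D′ a b w         ∎
    where open ≡-Reasoning

  size-cong : ∀ {D D′} → D ≗ D′ → size G D ≡ size G D′
  size-cong D≗D′ = cong sum (map-cong D≗D′ (allFin n))

  size-tabulate : ∀ D → size G D ≡ sum (tabulate D)
  size-tabulate D = cong sum (map-tabulate id D)

  size-+ : ∀ D D′ → size G (λ w → D w + D′ w) ≡ size G D + size G D′
  size-+ D D′ = begin
    size G (λ w → D w + D′ w)               ≡⟨ size-tabulate _ ⟩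
    sum (tabulate (λ w → D w + D′ w))       ≡⟨ sum-tabulate-+ D D′ ⟩
    sum (tabulate D) + sum (tabulate D′)   ≡⟨ cong₂ _+_ (size-tabulate D) (size-tabulate D′) ⟨
    size G D + size G D′                   ∎
    where open ≡-Reasoning

  size-δ : ∀ k a → size G (δ k a) ≡ k
  size-δ k a = trans (size-tabulate (δ k a)) (sum-tabulate-δ k a)

  size-∸δ : ∀ D k a → k ≤ D a → size G (λ w → D w ∸ δ k a w) + k ≡ size G D
  size-∸δ D k a k≤Da = begin
    size G D∸δ + k                          ≡⟨ cong (size G D∸δ +_) (size-δ k a) ⟨
    size G D∸δ + size G (δ k a)             ≡⟨ size-+ _ _ ⟨
    size G (λ w → D w ∸ δ k a w + δ k a w)  ≡⟨ size-cong (λ w → m∸n+n≡m (δ-≤ k≤Da w)) ⟩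
    size G D                                ∎
    where
    open ≡-Reasoning
    D∸δ : Dist G
    D∸δ w = D w ∸ δ k a w

  size-applyStep : ∀ D a b → 2 ≤ D a → suc (size G (applyStep G D a b)) ≡ size G D
  size-applyStep D a b 2≤Da = begin
    suc (size G (applyStep G D a b))              ≡⟨ cong suc (size-cong (applyStep-δ D a b)) ⟩
    suc (size G (λ w → D∸δ w + δ 1 b w))          ≡⟨ cong suc (size-+ _ _) ⟩
    suc (size G D∸δ + size G (δ 1 b))             ≡⟨ cong (λ x → suc (size G D∸δ + x)) (size-δ 1 b) ⟩
    suc (size G D∸δ + 1)                          ≡⟨ +-suc _ 1 ⟨
    size G D∸δ + 2                                ≡⟨ size-∸δ D 2 a 2≤Da ⟩
    size G D                                      ∎
    where
    open ≡-Reasoning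
    D∸δ : Dist G
    D∸δ w = D w ∸ δ 2 a w

  size-removeOne : ∀ D v → 1 ≤ D v → suc (size G (removeOne G D v)) ≡ size G D
  size-removeOne D v 1≤Dv = begin
    suc (size G (removeOne G D v))           ≡⟨ cong suc (size-cong (removeOne-δ D v)) ⟩
    suc (size G (λ w → D w ∸ δ 1 v w))       ≡⟨ +-comm 1 _ ⟩
    size G (λ w → D w ∸ δ 1 v w) + 1         ≡⟨ size-∸δ D 1 v 1≤Dv ⟩
    size G D                                 ∎
    where open ≡-Reasoning

  size≡suc⇒occupied : ∀ D {m} → size G D ≡ suc m → ∃[ v ] 1 ≤ D v
  size≡suc⇒occupied D size≡ with any? (λ v → 1 ≤? D v)
  ... | yes found = found
  ... | no  none  = contradiction (trans (sym size≡) (trans (size-cong empty) size-0)) λ ()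
    where
    empty : D ≗ λ _ → 0
    empty v = n<1⇒n≡0 (≰⇒> λ 1≤Dv → none (v , 1≤Dv))
    size-0 : size G (λ _ → 0) ≡ 0
    size-0 = trans (size-tabulate _) (sum-tabulate-0 n)

  _≤ᴰ_ : Dist G → Dist G → Set
  D ≤ᴰ D′ = ∀ w → D w ≤ D′ w

  applyStep-mono : ∀ {D D′} a b → D ≤ᴰ D′ → applyStep G D a b ≤ᴰ applyStep G D′ a b
  applyStep-mono {D} {D′} a b D≤D′ w
    rewrite applyStep-δ D a b w | applyStep-δ D′ a b w =
      +-monoˡ-≤ (δ 1 b w) (∸-monoˡ-≤ (δ 2 a w) (D≤D′ w))

  removeOne-mono : ∀ {D D′} v → D ≤ᴰ D′ → removeOne G D v ≤ᴰ removeOne G D′ v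
  removeOne-mono {D} {D′} v D≤D′ w
    rewrite removeOne-δ D v w | removeOne-δ D′ v w = ∸-monoˡ-≤ (δ 1 v w) (D≤D′ w)

  removeOne-≤ : ∀ D v → removeOne G D v ≤ᴰ D
  removeOne-≤ D v w rewrite removeOne-δ D v w = m∸n≤m (D w) (δ 1 v w)

  SolvableBy : (Fin n → Fin n → Set) → Dist G → Fin n → Set
  SolvableBy P D r = ∃[ E ] Reach G P D E × 1 ≤ E r

  reach-mono : ∀ {P D D′ E} → D ≤ᴰ D′ → Reach G P D E → ∃[ E′ ] Reach G P D′ E′ × E ≤ᴰ E′
  reach-mono D≤D′ done = _ , done , D≤D′
  reach-mono D≤D′ (step a b adj 2≤Da p R) with reach-mono (applyStep-mono a b D≤D′) R
  ... | E′ , R′ , E≤E′ = E′ , step a b adj (≤-trans 2≤Da (D≤D′ a)) p R′ , E≤E′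

  solvableBy-mono : ∀ {P D D′ r} → D ≤ᴰ D′ → SolvableBy P D r → SolvableBy P D′ r
  solvableBy-mono {r = r} D≤D′ (E , R , 1≤Er) with reach-mono D≤D′ R
  ... | E′ , R′ , E≤E′ = E′ , R′ , ≤-trans 1≤Er (E≤E′ r)

  subdistribution : ∀ k D → k ≤ size G D → ∃[ D′ ] D′ ≤ᴰ D × size G D′ ≡ k
  subdistribution k D k≤size = remove (size G D ∸ k) D (sym (m∸n+n≡m k≤size))
    where
    remove : ∀ j D → size G D ≡ j + k → ∃[ D′ ] D′ ≤ᴰ D × size G D′ ≡ k
    remove zero    D size≡ = D , (λ _ → ≤-refl) , size≡
    remove (suc j) D size≡ with size≡suc⇒occupied D size≡
    ... | v , 1≤Dv
      with remove j (removeOne G D v) (suc-injective (trans (size-removeOne D v 1≤Dv) size≡))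
    ... | D′ , D′≤ , size≡′ = D′ , (λ w → ≤-trans (D′≤ w) (removeOne-≤ D v w)) , size≡′

  Reducible : Dist G → Fin n → Set
  Reducible D r = ∃[ v ] 1 ≤ D v × Solvable G (removeOne G D v) r

  AllReducible : ℕ → Fin n → Set
  AllReducible m r = ∀ D → size G D ≡ m → Reducible D r

  reducible-mono : ∀ {D D′ r} → D ≤ᴰ D′ → Reducible D r → Reducible D′ r
  reducible-mono D≤D′ (v , 1≤Dv , solvable) =
    v , ≤-trans 1≤Dv (D≤D′ v) , solvableBy-mono (removeOne-mono v D≤D′) solvable

  reducible⇒solvable : ∀ {D r} → Reducible D r → Solvable G D r
  reducible⇒solvable {D} (v , _ , solvable) = solvableBy-mono (removeOne-≤ D v) solvable

  critical⇒size< : ∀ {m D r} → AllReducible m r → Critical G D r → size G D < m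
  critical⇒size< {m} {D} reducible (_ , minimal) with m ≤? size G D
  ... | no  m≰size = ≰⇒> m≰size
  ... | yes m≤size with subdistribution m D m≤size
  ...   | D′ , D′≤D , size≡ with reducible-mono D′≤D (reducible D′ size≡)
  ...     | v , 1≤Dv , solvable = contradiction solvable (minimal v 1≤Dv)

  isPebblingNumber : ∀ {m D₀ r₀} → (∀ r → AllReducible (suc m) r) →
                     size G D₀ ≡ m → ¬ Solvable G D₀ r₀ → IsPebblingNumber G (suc m)
  isPebblingNumber {D₀ = D₀} {r₀} reducible size≡ unsolvable =
    (λ D r size≡′ → reducible⇒solvable (reducible r D size≡′)) , smaller
    where
    smaller : ∀ q → q < suc _ → ¬ (∀ D r → size G D ≡ q → Solvable G D r)
    smaller q q<1+m solvable with subdistribution q D₀ (subst (q ≤_) (sym size≡) (≤-pred q<1+m))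
    ... | D′ , D′≤D₀ , size≡′ = unsolvable (solvableBy-mono D′≤D₀ (solvable D′ r₀ size≡′))

  isCriticalCeiling : ∀ {m D₀ r₀} → (∀ r → AllReducible (suc m) r) →
                      Critical G D₀ r₀ → size G D₀ ≡ m → IsCriticalCeiling G m
  isCriticalCeiling {D₀ = D₀} {r₀} reducible critical size≡ =
    (r₀ , D₀ , critical , size≡) , λ r D critical′ → ≤-pred (critical⇒size< (reducible r) critical′)

  module Automorphism (π : Fin n → Fin n) (π-injective : ∀ {a b} → π a ≡ π b → a ≡ b)
                      (π-adj : ∀ {a b} → Adj a b → Adj (π a) (π b)) where

    applyStep-∘ : ∀ {D′ D} a b → D′ ≗ D ∘ π → applyStep G D′ a b ≗ applyStep G D (π a) (π b) ∘ π
    applyStep-∘ {D′} {D} a b D′≗ w = begin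
      applyStep G D′ a b w                         ≡⟨ applyStep-δ D′ a b w ⟩
      D′ w ∸ δ 2 a w + δ 1 b w                     ≡⟨ cong (λ x → x ∸ δ 2 a w + δ 1 b w) (D′≗ w) ⟩
      D (π w) ∸ δ 2 a w + δ 1 b w                  ≡⟨ cong₂ (λ x y → D (π w) ∸ x + y)
                                                        (δ-injective π-injective 2 a w)
                                                        (δ-injective π-injective 1 b w) ⟨
      D (π w) ∸ δ 2 (π a) (π w) + δ 1 (π b) (π w)  ≡⟨ applyStep-δ D (π a) (π b) (π w) ⟨
      applyStep G D (π a) (π b) (π w)              ∎
      where open ≡-Reasoning

    removeOne-∘ : ∀ D v → removeOne G (D ∘ π) v ≗ removeOne G D (π v) ∘ π
    removeOne-∘ D v w = begin
      removeOne G (D ∘ π) v w          ≡⟨ removeOne-δ (D ∘ π) v w ⟩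
      D (π w) ∸ δ 1 v w                ≡⟨ cong (D (π w) ∸_) (δ-injective π-injective 1 v w) ⟨
      D (π w) ∸ δ 1 (π v) (π w)        ≡⟨ removeOne-δ D (π v) (π w) ⟨
      removeOne G D (π v) (π w)        ∎
      where open ≡-Reasoning

    reach-∘ : ∀ {D′ D E′} → D′ ≗ D ∘ π → Reach G (NoRestriction G) D′ E′ →
              ∃[ E ] Reach G (NoRestriction G) D E × E′ ≗ E ∘ π
    reach-∘ D′≗ done = _ , done , D′≗
    reach-∘ {D = D} D′≗ (step a b adj 2≤D′a _ R)
      with reach-∘ {D = applyStep G D (π a) (π b)} (applyStep-∘ {D = D} a b D′≗) R
    ... | E , R′ , E′≗ = E , step (π a) (π b) (π-adj adj) (subst (2 ≤_) (D′≗ a) 2≤D′a) _ R′ , E′≗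

    solvable-∘ : ∀ {D′ D r} → D′ ≗ D ∘ π → Solvable G D′ r → Solvable G D (π r)
    solvable-∘ {r = r} D′≗ (E′ , R , 1≤E′r) with reach-∘ D′≗ R
    ... | E , R′ , E′≗ = E , R′ , subst (1 ≤_) (E′≗ r) 1≤E′r

    allReducible-∘ : (∀ D → size G (D ∘ π) ≡ size G D) →
                     ∀ {m r} → AllReducible m r → AllReducible m (π r)
    allReducible-∘ size-∘ reducible D size≡ with reducible (D ∘ π) (trans (size-∘ D) size≡)
    ... | v , 1≤Dπv , solvable = π v , 1≤Dπv , solvable-∘ (removeOne-∘ D v) solvable

  applyStep-lookup : ∀ t a b → applyStep G (lookup t) a b ≗ lookup (stepᵛ t a b)
  applyStep-lookup t a b w = begin
    applyStep G (lookup t) a b w              ≡⟨ applyStep-δ (lookup t) a b w ⟩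
    lookup t w ∸ δ 2 a w + δ 1 b w            ≡⟨ cong (_+ δ 1 b w) (lookup-updateAt-∸ t 2 a w) ⟨
    lookup (updateAt t a (_∸ 2)) w + δ 1 b w  ≡⟨ lookup-updateAt-+ (updateAt t a (_∸ 2)) 1 b w ⟨
    lookup (stepᵛ t a b) w                    ∎
    where open ≡-Reasoning

  removeOne-lookup : ∀ t v → removeOne G (lookup t) v ≗ lookup (removeᵛ t v)
  removeOne-lookup t v w = trans (removeOne-δ (lookup t) v w) (sym (lookup-updateAt-∸ t 1 v w))

  module Search (moves : List (Fin n × Fin n))
                (moves-complete : ∀ {a b} → Adj a b → (a , b) ∈ moves)
                (adj? : ∀ a b → Dec (Adj a b))
                (P : Fin n → Fin n → Set) (P? : ∀ a b → Dec (P a b)) (r : Fin n) where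

    legal : Vec ℕ n → Fin n → Fin n → Bool
    legal t a b = (2 ≤ᵇ lookup t a) ∧ isYes (adj? a b) ∧ isYes (P? a b)

    reaches : ℕ → Vec ℕ n → Bool
    reaches zero    t = 1 ≤ᵇ lookup t r
    reaches (suc k) t =
      (1 ≤ᵇ lookup t r) ∨ any (λ (a , b) → legal t a b ∧ reaches k (stepᵛ t a b)) moves

    stepᵛ-≗ : ∀ {D t} a b → D ≗ lookup t → applyStep G D a b ≗ lookup (stepᵛ t a b)
    stepᵛ-≗ {t = t} a b D≗t w = trans (applyStep-cong a b D≗t w) (applyStep-lookup t a b w)

    legal-sound : ∀ {D t a b} → D ≗ lookup t → T (legal t a b) → Adj a b × 2 ≤ D a × P a b
    legal-sound {D} {t} {a} {b} D≗t legal-ab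
      with 2≤ta , rest ← Equivalence.to (T-∧ {2 ≤ᵇ lookup t a}) legal-ab
      with adj , p ← Equivalence.to (T-∧ {isYes (adj? a b)}) rest =
      toWitness {a? = adj? a b} adj , subst (2 ≤_) (sym (D≗t a)) (≤ᵇ⇒≤ 2 (lookup t a) 2≤ta) ,
      toWitness {a? = P? a b} p

    legal-complete : ∀ {D t a b} → D ≗ lookup t → Adj a b → 2 ≤ D a → P a b → T (legal t a b)
    legal-complete {D} {t} {a} {b} D≗t adj 2≤Da p =
      Equivalence.from T-∧ (≤⇒≤ᵇ (subst (2 ≤_) (D≗t a) 2≤Da) , Equivalence.from T-∧
        (fromWitness {a? = adj? a b} adj , fromWitness {a? = P? a b} p))

    solvable-now : ∀ {D t} → D ≗ lookup t → T (1 ≤ᵇ lookup t r) → SolvableBy P D r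
    solvable-now {t = t} D≗t now = _ , done , subst (1 ≤_) (sym (D≗t r)) (≤ᵇ⇒≤ 1 (lookup t r) now)

    solvable-step : ∀ {D t a b} → D ≗ lookup t → T (legal t a b) →
                    SolvableBy P (applyStep G D a b) r → SolvableBy P D r
    solvable-step {t = t} {a} {b} D≗t legal-ab (E , R , 1≤Er)
      with adj , 2≤Da , p ← legal-sound {t = t} D≗t legal-ab = E , step a b adj 2≤Da p R , 1≤Er

    reaches-sound : ∀ k t {D} → D ≗ lookup t → T (reaches k t) → SolvableBy P D r
    reaches-sound zero t D≗t now = solvable-now {t = t} D≗t now
    reaches-sound (suc k) t {D} D≗t found with Equivalence.to T-∨ found
    ... | inj₁ now = solvable-now {t = t} D≗t now
    ... | inj₂ later
      with (a , b) , legal-and-reaches ← satisfied (any⁻ _ moves later)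
      with legal-ab , reaches-ab ← Equivalence.to (T-∧ {legal t a b}) legal-and-reaches
      = solvable-step {t = t} D≗t legal-ab
          (reaches-sound k (stepᵛ t a b) (stepᵛ-≗ {t = t} a b D≗t) reaches-ab)

    run : Vec ℕ n → List (Fin n × Fin n) → Bool
    run t []            = 1 ≤ᵇ lookup t r
    run t ((a , b) ∷ s) = legal t a b ∧ run (stepᵛ t a b) s

    run-sound : ∀ s t {D} → D ≗ lookup t → T (run t s) → SolvableBy P D r
    run-sound []            t D≗t now = solvable-now {t = t} D≗t now
    run-sound ((a , b) ∷ s) t D≗t ok
      with legal-ab , rest ← Equivalence.to (T-∧ {legal t a b}) ok
      = solvable-step {t = t} D≗t legal-ab
          (run-sound s (stepᵛ t a b) (stepᵛ-≗ {t = t} a b D≗t) rest)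

    reaches-now : ∀ k t → 1 ≤ lookup t r → T (reaches k t)
    reaches-now zero    t 1≤tr = ≤⇒≤ᵇ 1≤tr
    reaches-now (suc k) t 1≤tr = Equivalence.from T-∨ (inj₁ (≤⇒≤ᵇ 1≤tr))

    reaches-complete : ∀ k t {D E} → Reach G P D E → 1 ≤ E r → D ≗ lookup t → size G D ≤ k →
                       T (reaches k t)
    reaches-complete k t done 1≤Dr D≗t _ = reaches-now k t (subst (1 ≤_) (D≗t r) 1≤Dr)
    reaches-complete zero t {D} (step a b _ 2≤Da _ _) _ _ size≤0
      with () ← ≤-trans (≤-reflexive (size-applyStep D a b 2≤Da)) size≤0
    reaches-complete (suc k) t {D} (step a b adj 2≤Da p R) 1≤Er D≗t size≤
      = Equivalence.from T-∨ (inj₂ (any⁺ _ (lose (moves-complete adj)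
          (Equivalence.from T-∧ (legal-complete {t = t} D≗t adj 2≤Da p ,
             reaches-complete k (stepᵛ t a b) R 1≤Er (stepᵛ-≗ {t = t} a b D≗t)
               (≤-pred (≤-trans (≤-reflexive (size-applyStep D a b 2≤Da)) size≤)))))))

    solvableBy? : ∀ D → Dec (SolvableBy P D r)
    solvableBy? D with T? (reaches (size G D) (Vec.tabulate D))
    ... | yes found  = yes (reaches-sound (size G D) (Vec.tabulate D) D≗ found)
      where D≗ = λ w → sym (lookup∘tabulate D w)
    ... | no  ¬found = no λ (_ , R , 1≤Er) →
      ¬found (reaches-complete (size G D) (Vec.tabulate D) R 1≤Er D≗ ≤-refl)
      where D≗ = λ w → sym (lookup∘tabulate D w)

open Graph C7 using (Adj; dist)
open Pebbling C7

σ : Fin 7 → Fin 7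
σ i = fromℕ< (m%n<n (toℕ i + 1) 7)

toℕ-σ : ∀ i → toℕ (σ i) ≡ (toℕ i + 1) % 7
toℕ-σ i = toℕ-fromℕ< _

adj⇒σ : ∀ {a b} → Adj a b → b ≡ σ a ⊎ a ≡ σ b
adj⇒σ {a} (inj₁ b≡) = inj₁ (toℕ-injective (trans b≡ (sym (toℕ-σ a))))
adj⇒σ {b = b} (inj₂ a≡) = inj₂ (toℕ-injective (trans a≡ (sym (toℕ-σ b))))

σ⇒adj : ∀ {a b} → b ≡ σ a ⊎ a ≡ σ b → Adj a b
σ⇒adj {a} (inj₁ refl) = inj₁ (toℕ-σ a)
σ⇒adj {b = b} (inj₂ refl) = inj₂ (toℕ-σ b)

σ-adj : ∀ {a b} → Adj a b → Adj (σ a) (σ b)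
σ-adj adj with adj⇒σ adj
... | inj₁ b≡σa = σ⇒adj (inj₁ (cong σ b≡σa))
... | inj₂ a≡σb = σ⇒adj (inj₂ (cong σ a≡σb))

adjᵇ : Fin 7 → Fin 7 → Bool
adjᵇ a b = (toℕ b ≡ᵇ (toℕ a + 1) % 7) ∨ (toℕ a ≡ᵇ (toℕ b + 1) % 7)

adjᵇ-sound : ∀ a b → T (adjᵇ a b) → Adj a b
adjᵇ-sound a b adj with Equivalence.to T-∨ adj
... | inj₁ b≡ = inj₁ (≡ᵇ⇒≡ (toℕ b) _ b≡)
... | inj₂ a≡ = inj₂ (≡ᵇ⇒≡ (toℕ a) _ a≡)

adjᵇ-complete : ∀ a b → Adj a b → T (adjᵇ a b)
adjᵇ-complete a b (inj₁ b≡) = Equivalence.from T-∨ (inj₁ (≡⇒≡ᵇ (toℕ b) _ b≡))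
adjᵇ-complete a b (inj₂ a≡) = Equivalence.from T-∨ (inj₂ (≡⇒≡ᵇ (toℕ a) _ a≡))

adj? : ∀ a b → Dec (Adj a b)
adj? a b = map′ (adjᵇ-sound a b) (adjᵇ-complete a b) (T? (adjᵇ a b))

σ-injective : ∀ {a b} → σ a ≡ σ b → a ≡ b
σ-injective {a} {b} = from-yes (all? λ a → all? λ b → (σ a ≟ σ b) →-dec (a ≟ b)) a b

edgesAt : Fin 7 → List (Fin 7 × Fin 7)
edgesAt a = (a , σ a) ∷ (σ a , a) ∷ []

edges : List (Fin 7 × Fin 7)
edges = concatMap edgesAt (allFin 7)

edges-complete : ∀ {a b} → Adj a b → (a , b) ∈ edges
edges-complete {a} {b} adj with adj⇒σ adj
... | inj₁ refl = ∈-concatMap⁺ edgesAt (lose (∈-allFin a) (here refl))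
... | inj₂ refl = ∈-concatMap⁺ edgesAt (lose (∈-allFin b) (there (here refl)))

size-∘σ : ∀ D → size C7 (D ∘ σ) ≡ size C7 D
size-∘σ D = begin
  sum (rest ++ D zero ∷ [])   ≡⟨ sum-++ rest (D zero ∷ []) ⟩
  sum rest + (D zero + 0)     ≡⟨ +-comm _ (D zero + 0) ⟩
  D zero + 0 + sum rest       ≡⟨ cong (_+ sum rest) (+-identityʳ (D zero)) ⟩
  D zero + sum rest           ∎
  where
  open ≡-Reasoning
  rest : List ℕ
  rest = map D (tabulate suc)

σ^ : ℕ → Fin 7
σ^ zero    = zero
σ^ (suc k) = σ (σ^ k)

σ^-toℕ : ∀ r → σ^ (toℕ r) ≡ r
σ^-toℕ = from-yes (all? λ r → σ^ (toℕ r) ≟ r)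

module Rotation = Automorphism σ σ-injective σ-adj

allReducible-everywhere : ∀ {m} → AllReducible m zero → ∀ r → AllReducible m r
allReducible-everywhere {m} reducible r = subst (AllReducible m) (σ^-toℕ r) (orbit (toℕ r))
  where
  orbit : ∀ k → AllReducible m (σ^ k)
  orbit zero    = reducible
  orbit (suc k) = Rotation.allReducible-∘ size-∘σ (orbit k)

module Search₀ = Search edges edges-complete adj? (NoRestriction C7) (λ _ _ → yes tt) zero
module Greedy₀ = Search edges edges-complete adj?
                    (GreedyStep C7 zero) (λ a b → dist b zero <? dist a zero) zero

-- Both arcs start with a non-greedy step: 3 and 4 are both at distance 3 from 0.
routes₀ : List (List (Fin 7))
routes₀ = (# 4 ∷ # 3 ∷ # 2 ∷ # 1 ∷ # 0 ∷ []) ∷ (# 3 ∷ # 4 ∷ # 5 ∷ # 6 ∷ # 0 ∷ []) ∷ []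

sweepSolves : Vec ℕ 7 → List (Fin 7) → Bool
sweepSolves t route = Search₀.run t (sweep t route)

removable : Vec ℕ 7 → Fin 7 → Bool
removable t v = (1 ≤ᵇ lookup t v) ∧ any (sweepSolves (removeᵛ t v)) routes₀

-- T (all reducibleᵇ …) is a unit type, which the type checker normalises whenever it
-- eta-expands it; the opacity of reducibleᵇ keeps that from rerunning the whole check at
-- every use.  The same eta rule solves the underscore below.
opaque
  reducibleᵇ : Vec ℕ 7 → Bool
  reducibleᵇ t = any (removable t) (allFin 7)

opaque
  unfolding reducibleᵇ

  reducibleᵇ-all : T (all reducibleᵇ (compositions 7 11))
  reducibleᵇ-all = _

  reducibleᵇ-sound : ∀ t → T (reducibleᵇ t) → Reducible (lookup t) zero
  reducibleᵇ-sound t ok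
    with v , removable-v ← satisfied (any⁻ (removable t) (allFin 7) ok)
    with 1≤tv , solvable ← Equivalence.to (T-∧ {1 ≤ᵇ lookup t v}) removable-v
    with route , certified ← satisfied (any⁻ (sweepSolves (removeᵛ t v)) routes₀ solvable)
    = v , ≤ᵇ⇒≤ 1 (lookup t v) 1≤tv ,
      Search₀.run-sound (sweep (removeᵛ t v) route) (removeᵛ t v)
        (removeOne-lookup t v) certified

reducibleᵇ-∈ : ∀ {t} → t ∈ compositions 7 11 → T (reducibleᵇ t)
reducibleᵇ-∈ = All.lookup (all⁺ reducibleᵇ (compositions 7 11) reducibleᵇ-all)

sumᵛ-tabulate : ∀ D → Vec.sum (Vec.tabulate D) ≡ size C7 D
sumᵛ-tabulate D = refl

allReducible₀ : AllReducible 11 zero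
allReducible₀ D size≡ = reducible-mono (λ w → ≤-reflexive (lookup∘tabulate D w))
  (reducibleᵇ-sound (Vec.tabulate D) (reducibleᵇ-∈ {Vec.tabulate D}
    (subst (λ s → Vec.tabulate D ∈ compositions 7 s) (trans (sumᵛ-tabulate D) size≡)
      (∈-compositions (Vec.tabulate D)))))

allReducible : ∀ r → AllReducible 11 r
allReducible = allReducible-everywhere allReducible₀

critical₀? : ∀ D → Dec (Critical C7 D zero)
critical₀? D = Search₀.solvableBy? D
         ×-dec all? (λ v → (1 ≤? D v) →-dec ¬? (Search₀.solvableBy? (removeOne C7 D v)))

X W Y : Dist C7
X = lookup (0 ∷ 0 ∷ 0 ∷ 5 ∷ 5 ∷ 0 ∷ 0 ∷ [])
W = lookup (0 ∷ 0 ∷ 0 ∷ 4 ∷ 6 ∷ 0 ∷ 0 ∷ [])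
Y = lookup (0 ∷ 0 ∷ 0 ∷ 4 ∷ 7 ∷ 0 ∷ 0 ∷ [])

pebblingNumber : IsPebblingNumber C7 11
pebblingNumber = isPebblingNumber allReducible refl (from-no (Search₀.solvableBy? X))

W-critical : Critical C7 W zero
W-critical = from-yes (critical₀? W)

W-ungreedy : ¬ GreedySolvable C7 W zero
W-ungreedy = from-no (Greedy₀.solvableBy? W)

Y-ungreedy : ¬ GreedySolvable C7 Y zero
Y-ungreedy = from-no (Greedy₀.solvableBy? Y)

criticalCeiling : IsCriticalCeiling C7 10
criticalCeiling = isCriticalCeiling allReducible W-critical refl

theorem17 : ¬ IsThrifty C7 × ¬ IsGreedyGraph C7 × Σ _ (λ c → IsCriticalCeiling C7 c × 2 ^ 3 < c)
theorem17 =
  (λ thrifty → W-ungreedy (thrifty 10 criticalCeiling zero W W-critical refl)) ,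
  (λ greedy → Y-ungreedy (greedy 11 pebblingNumber Y zero ≤-refl)) ,
  (10 , criticalCeiling , from-yes (2 ^ 3 <? 10))
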